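{- Among the graphs $F_0$, the even $k$-sun ($k\ge 4$ even), $F_1(k)$ ($k \ge 5$ odd) and $F_2(k)$ ($k\ge5$ odd), the only comparability graphs are $F_0$ and $F_1(5)$.
   Context: A comparability graph is a graph admitting a transitive orientation. In each graph below, the vertices listed in $C$ form a clique, the vertices in $I$ form an independent set, and the only remaining edges are given by the neighbourhoods $N(\cdot)$ of the vertices of $I$. $F_0$: $C=\{0,c_1,c_2,c_3,c_4\}$, $I=\{a_1,a_2,a_3\}$, $N(a_1)=\{0,c_2,c_3\}$, $N(a_2)=\{0,c_3,c_4\}$, $N(a_3)=\{0,c_1,c_4\}$. Even $k$-sun ($k\ge4$ even): $C=\{c_1,\dots,c_k\}$, $I=\{a_1,\dots,a_k\}$, $N(a_i)=\{c_i,c_{i+1}\}$ for $1\le i\le k-1$, $N(a_k)=\{c_1,c_k\}$. $F_1(k)$ ($k\ge5$ odd): $C=\{c_1,\dots,c_{k-1}\}$, $I=\{b_1,b_2,a_1,\dots,a_{k-2}\}$, $N(b_1)=\{c_1,\dots,c_{k-2}\}$, $N(b_2)=\{c_2,\dots,c_{k-1}\}$, $N(a_i)=\{c_i,c_{i+1}\}$ for $1\le i\le k-2$. $F_2(k)$ ($k\ge5$ odd): $C=\{c_1,\dots,c_k\}$, $I=\{b,a_1,\dots,a_{k-1}\}$, $N(b)=\{c_2,\dots,c_{k-1}\}$, $N(a_i)=\{c_i,c_{i+1}\}$ for $1\le i\le k-1$. -}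

module Defs where

open import Data.Nat using (ℕ; zero; suc; _+_; _*_; _∸_; _≤_; _<_)
open import Data.Fin using (Fin; toℕ; zero; suc)
open import Data.Sum using (_⊎_; inj₁; inj₂)
open import Data.Product using (Σ; _×_; ∃)
open import Data.Unit using (⊤; tt)
open import Data.Empty using (⊥)
open import Data.Bool using (Bool; true; false; T)
open import Relation.Nullary using (¬_)
open import Relation.Binary.PropositionalEquality using (_≡_; _≢_)

record Graph : Set₁ where
  field
    V : Set
    E : V → V → Set

open Graph public

record IsTransitiveOrientation (G : Graph) (O : V G → V G → Set) : Set where
  field
    onlyEdges  : ∀ u v → O u v → E G u v
    covers     : ∀ u v → E G u v → O u v ⊎ O v u
    asym       : ∀ u v → O u v → ¬ O v u
    transitive : ∀ u v w → O u v → O v w → O u w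

IsComparability : Graph → Set₁
IsComparability G = ∃ λ (O : V G → V G → Set) → IsTransitiveOrientation G O

-- Split graph with clique C, independent set I, and the only remaining edges
-- given by the neighbourhoods N a ⊆ C of a ∈ I.
SplitEdge : (C I : Set) → (I → C → Set) → C ⊎ I → C ⊎ I → Set
SplitEdge C I N (inj₁ c) (inj₁ c') = c ≢ c'
SplitEdge C I N (inj₁ c) (inj₂ a)  = N a c
SplitEdge C I N (inj₂ a) (inj₁ c)  = N a c
SplitEdge C I N (inj₂ a) (inj₂ a') = ⊥

splitGraph : (C I : Set) → (I → C → Set) → Graph
splitGraph C I N = record { V = C ⊎ I ; E = SplitEdge C I N }

Even Odd : ℕ → Set
Even k = ∃ λ m → k ≡ 2 * m
Odd  k = ∃ λ m → k ≡ suc (2 * m)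

-- Indexing convention: clique vertex c_j (1-based) is the element of Fin
-- with toℕ = j - 1; likewise a_i is the element with toℕ = i - 1.

-- F₀: C = {0,c1,c2,c3,c4} as Fin 5 (0 ↦ 0, c_i ↦ i), I = {a1,a2,a3} as Fin 3.
F0-table : Fin 3 → Fin 5 → Bool
F0-table zero c = (toℕ c Data.Nat.≡ᵇ 0) Data.Bool.∨ (toℕ c Data.Nat.≡ᵇ 2) Data.Bool.∨ (toℕ c Data.Nat.≡ᵇ 3)
F0-table (suc zero) c = (toℕ c Data.Nat.≡ᵇ 0) Data.Bool.∨ (toℕ c Data.Nat.≡ᵇ 3) Data.Bool.∨ (toℕ c Data.Nat.≡ᵇ 4)
F0-table (suc (suc zero)) c = (toℕ c Data.Nat.≡ᵇ 0) Data.Bool.∨ (toℕ c Data.Nat.≡ᵇ 1) Data.Bool.∨ (toℕ c Data.Nat.≡ᵇ 4)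

F0 : Graph
F0 = splitGraph (Fin 5) (Fin 3) (λ a c → T (F0-table a c))

-- Even k-sun: C = Fin k, I = Fin k, N(a_i) = {c_i, c_{i+1}}, N(a_k) = {c_1, c_k}.
sunN : (k : ℕ) → Fin k → Fin k → Set
sunN k a c = (toℕ c ≡ toℕ a) ⊎ (toℕ c ≡ suc (toℕ a)) ⊎ (suc (toℕ a) ≡ k × toℕ c ≡ 0)

sun : ℕ → Graph
sun k = splitGraph (Fin k) (Fin k) (sunN k)

-- F₁(k): C = Fin (k-1), I = {b1,b2} ⊎ {a_1..a_{k-2}} = Fin 2 ⊎ Fin (k-2).
F1N : (k : ℕ) → Fin 2 ⊎ Fin (k ∸ 2) → Fin (k ∸ 1) → Set
F1N k (inj₁ zero) c       = toℕ c < k ∸ 2        -- c_1 .. c_{k-2}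
F1N k (inj₁ (suc zero)) c = 1 ≤ toℕ c            -- c_2 .. c_{k-1}
F1N k (inj₂ a) c          = (toℕ c ≡ toℕ a) ⊎ (toℕ c ≡ suc (toℕ a))

F1 : ℕ → Graph
F1 k = splitGraph (Fin (k ∸ 1)) (Fin 2 ⊎ Fin (k ∸ 2)) (F1N k)

-- F₂(k): C = Fin k, I = {b} ⊎ {a_1..a_{k-1}} = ⊤ ⊎ Fin (k-1).
F2N : (k : ℕ) → ⊤ ⊎ Fin (k ∸ 1) → Fin k → Set
F2N k (inj₁ tt) c = (1 ≤ toℕ c) × (toℕ c < k ∸ 1)   -- c_2 .. c_{k-1}
F2N k (inj₂ a) c  = (toℕ c ≡ toℕ a) ⊎ (toℕ c ≡ suc (toℕ a))

F2 : ℕ → Graph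
F2 k = splitGraph (Fin k) (⊤ ⊎ Fin (k ∸ 1)) (F2N k)

-- In a transitive orientation, a → x forces z → x for every neighbour z of x
-- not adjacent to a (and dually).  So in a split graph an ear a on clique
-- vertices x, y orients ax and ay alike as soon as another ear sees a clique
-- vertex u ∉ N(a) but misses x and y: otherwise the edge xu or yu would be
-- forced both ways.  With ears a₁, …, a₄ on consecutive clique edges c₁c₂,
-- c₂c₃, c₃c₄, c₄c₅ (suns, F₂(k), and F₁(k) for k ≥ 7) this aligns a₁ on c₁c₂
-- and a₂ on c₂c₃, and the two alignments force c₁c₃ or c₂c₄ both ways.
-- F₀ and F₁(5) are transitively oriented along a ranking of their vertices.
module Submission where

open import Defs
open import Data.Nat using (ℕ; zero; suc; _+_; _≤_; _<_; s≤s; _<?_; _≤?_)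
open import Data.Nat.Properties using (_≟_; <-cmp; <-asym; <-trans; even≢odd; m≤n⇒m<n∨m≡n)
open import Data.Fin using (Fin; zero; suc; toℕ)
import Data.Fin.Properties as Fin
open import Data.Sum using (_⊎_; inj₁; inj₂; [_,_]; assocˡ; assocʳ)
open import Data.Product using (_×_; _,_; proj₁; proj₂)
open import Data.Empty using (⊥; ⊥-elim)
open import Function using (id; _∘_)
open import Function.Bundles using (_⇔_; mk⇔)
open import Level using (0ℓ)
open import Relation.Nullary using (¬_; Dec; no; contradiction)
open import Relation.Nullary.Decidable
  using (True; toWitness; map′; ¬?; T?; _×-dec_; _⊎-dec_; _→-dec_)
open import Relation.Unary using (Pred; Decidable)
open import Relation.Binary.Definitions using (Symmetric; DecidableEquality; tri<; tri≈; tri>)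
open import Relation.Binary.PropositionalEquality using (_≡_; _≢_; refl; sym)

module Forcing {G : Graph} {O : V G → V G → Set} (isTO : IsTransitiveOrientation G O)
               (E-sym : Symmetric (E G)) where
  open IsTransitiveOrientation isTO

  private variable a b u v w x y z : V G

  clash : O u v → O v u → ⊥
  clash = asym _ _

  forced-into : O a x → E G x z → ¬ E G a z → O z x
  forced-into {a} {x} {z} a→x x~z a≁z with covers x z x~z
  ... | inj₁ x→z = ⊥-elim (a≁z (onlyEdges a z (transitive a x z a→x x→z)))
  ... | inj₂ z→x = z→x

  forced-out-of : O x a → E G x z → ¬ E G a z → O x z
  forced-out-of {x} {a} {z} x→a x~z a≁z with covers x z x~z
  ... | inj₁ x→z = x→z
  ... | inj₂ z→x = ⊥-elim (a≁z (E-sym (onlyEdges z a (transitive z x a z→x x→a))))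

  Aligned : V G → V G → V G → Set
  Aligned a x y = (O a x × O a y) ⊎ (O x a × O y a)

  aligned : E G a x → E G a y → E G b u → ¬ E G a u → ¬ E G b x → ¬ E G b y →
            E G x u → E G y u → Aligned a x y
  aligned a~x a~y b~u a≁u b≁x b≁y x~u y~u
    with covers _ _ a~x | covers _ _ a~y | covers _ _ b~u
  ... | inj₁ a→x | inj₁ a→y | _        = inj₁ (a→x , a→y)
  ... | inj₂ x→a | inj₂ y→a | _        = inj₂ (x→a , y→a)
  ... | inj₁ a→x | inj₂ _   | inj₁ b→u =
    ⊥-elim (clash (forced-into a→x x~u a≁u) (forced-into b→u (E-sym x~u) b≁x))
  ... | inj₁ _   | inj₂ y→a | inj₂ u→b =
    ⊥-elim (clash (forced-out-of y→a y~u a≁u) (forced-out-of u→b (E-sym y~u) b≁y))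
  ... | inj₂ x→a | inj₁ _   | inj₂ u→b =
    ⊥-elim (clash (forced-out-of x→a x~u a≁u) (forced-out-of u→b (E-sym x~u) b≁x))
  ... | inj₂ _   | inj₁ a→y | inj₁ b→u =
    ⊥-elim (clash (forced-into a→y y~u a≁u) (forced-into b→u (E-sym y~u) b≁y))

  aligned-clash : Aligned a x y → Aligned b y w →
                  ¬ E G a w → ¬ E G a z → ¬ E G b x → ¬ E G b z →
                  E G x w → E G y z → ⊥
  aligned-clash (inj₁ (a→x , _)) (inj₁ (_ , b→w)) a≁w _ b≁x _ x~w _ =
    clash (forced-into a→x x~w a≁w) (forced-into b→w (E-sym x~w) b≁x)
  aligned-clash (inj₁ (_ , a→y)) (inj₂ (y→b , _)) _ a≁z _ b≁z _ y~z =
    clash (forced-into a→y y~z a≁z) (forced-out-of y→b y~z b≁z)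
  aligned-clash (inj₂ (_ , y→a)) (inj₁ (b→y , _)) _ a≁z _ b≁z _ y~z =
    clash (forced-out-of y→a y~z a≁z) (forced-into b→y y~z b≁z)
  aligned-clash (inj₂ (x→a , _)) (inj₂ (_ , w→b)) a≁w _ b≁x _ x~w _ =
    clash (forced-out-of x→a x~w a≁w) (forced-out-of w→b (E-sym x~w) b≁x)

module _ {C I : Set} (N : I → C → Set) where

  splitEdge-sym : Symmetric (SplitEdge C I N)
  splitEdge-sym {inj₁ _} {inj₁ _} c≢c′ = c≢c′ ∘ sym
  splitEdge-sym {inj₁ _} {inj₂ _} n    = n
  splitEdge-sym {inj₂ _} {inj₁ _} n    = n

  splitEdge? : DecidableEquality C → (∀ a c → Dec (N a c)) →
               ∀ u v → Dec (SplitEdge C I N u v)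
  splitEdge? _≟C_ _ (inj₁ c) (inj₁ c′) = ¬? (c ≟C c′)
  splitEdge? _    N? (inj₁ c) (inj₂ a)  = N? a c
  splitEdge? _    N? (inj₂ a) (inj₁ c)  = N? a c
  splitEdge? _    _  (inj₂ _) (inj₂ _)  = no id

PathNeighbour : ∀ {m n} → Fin m → Fin n → Set
PathNeighbour a c = toℕ c ≡ toℕ a ⊎ toℕ c ≡ suc (toℕ a)

CycleNeighbour : ∀ {k n} → Fin k → Fin n → Set
CycleNeighbour {k} a c = PathNeighbour a c ⊎ (suc (toℕ a) ≡ k × toℕ c ≡ 0)

consecutiveEars⇒¬isComparability :
  ∀ {m n} {I : Set} {N : I → Fin (4 + m) → Set} (ear : Fin (4 + n) → I) →
  (∀ {a c} → PathNeighbour a c → N (ear a) c) →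
  (∀ {a c} → N (ear a) c → CycleNeighbour a c) →
  ¬ IsComparability (splitGraph (Fin (4 + m)) I N)
consecutiveEars⇒¬isComparability {m} {n} {I} {N} ear path⊆N N⊆cycle (O , isTO) =
  aligned-clash {z = inj₁ c₄} a₁-aligned a₂-aligned
    a₁≁c₃ a₁≁c₄ a₂≁c₁ a₂≁c₄ (λ ()) (λ ())
  where
  open Forcing isTO (λ {u} {v} → splitEdge-sym N {u} {v})

  a₁ a₂ a₃ a₄ : Fin (4 + n)
  a₁ = zero
  a₂ = suc zero
  a₃ = suc (suc zero)
  a₄ = suc (suc (suc zero))

  c₁ c₂ c₃ c₄ : Fin (4 + m)
  c₁ = zero
  c₂ = suc zero
  c₃ = suc (suc zero)
  c₄ = suc (suc (suc zero))

  a₁≁c₃ : ¬ N (ear a₁) c₃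
  a₁≁c₃ = (λ { (inj₁ (inj₁ ())) ; (inj₁ (inj₂ ())) ; (inj₂ (_ , ())) }) ∘ N⊆cycle
  a₁≁c₄ : ¬ N (ear a₁) c₄
  a₁≁c₄ = (λ { (inj₁ (inj₁ ())) ; (inj₁ (inj₂ ())) ; (inj₂ (_ , ())) }) ∘ N⊆cycle
  a₂≁c₁ : ¬ N (ear a₂) c₁
  a₂≁c₁ = (λ { (inj₁ (inj₁ ())) ; (inj₁ (inj₂ ())) ; (inj₂ (() , _)) }) ∘ N⊆cycle
  a₂≁c₄ : ¬ N (ear a₂) c₄
  a₂≁c₄ = (λ { (inj₁ (inj₁ ())) ; (inj₁ (inj₂ ())) ; (inj₂ (_ , ())) }) ∘ N⊆cycle
  a₃≁c₁ : ¬ N (ear a₃) c₁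
  a₃≁c₁ = (λ { (inj₁ (inj₁ ())) ; (inj₁ (inj₂ ())) ; (inj₂ (() , _)) }) ∘ N⊆cycle
  a₃≁c₂ : ¬ N (ear a₃) c₂
  a₃≁c₂ = (λ { (inj₁ (inj₁ ())) ; (inj₁ (inj₂ ())) ; (inj₂ (_ , ())) }) ∘ N⊆cycle
  a₄≁c₂ : ¬ N (ear a₄) c₂
  a₄≁c₂ = (λ { (inj₁ (inj₁ ())) ; (inj₁ (inj₂ ())) ; (inj₂ (_ , ())) }) ∘ N⊆cycle
  a₄≁c₃ : ¬ N (ear a₄) c₃
  a₄≁c₃ = (λ { (inj₁ (inj₁ ())) ; (inj₁ (inj₂ ())) ; (inj₂ (_ , ())) }) ∘ N⊆cycle

  a₁-aligned : Aligned (inj₂ (ear a₁)) (inj₁ c₁) (inj₁ c₂)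
  a₁-aligned = aligned {b = inj₂ (ear a₃)} {u = inj₁ c₃}
    (path⊆N (inj₁ refl)) (path⊆N (inj₂ refl)) (path⊆N (inj₁ refl))
    a₁≁c₃ a₃≁c₁ a₃≁c₂ (λ ()) (λ ())

  a₂-aligned : Aligned (inj₂ (ear a₂)) (inj₁ c₂) (inj₁ c₃)
  a₂-aligned = aligned {b = inj₂ (ear a₄)} {u = inj₁ c₄}
    (path⊆N (inj₁ refl)) (path⊆N (inj₂ refl)) (path⊆N (inj₁ refl))
    a₂≁c₄ a₄≁c₂ a₄≁c₃ (λ ()) (λ ())

sun-¬isComparability : ∀ {k} → 4 ≤ k → ¬ IsComparability (sun k)
sun-¬isComparability (s≤s (s≤s (s≤s (s≤s _)))) =
  consecutiveEars⇒¬isComparability id (assocʳ ∘ inj₁) assocˡ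

F₂-¬isComparability : ∀ {k} → 5 ≤ k → ¬ IsComparability (F2 k)
F₂-¬isComparability (s≤s (s≤s (s≤s (s≤s (s≤s _))))) =
  consecutiveEars⇒¬isComparability inj₂ id inj₁

F₁-¬isComparability : ∀ {k} → 7 ≤ k → ¬ IsComparability (F1 k)
F₁-¬isComparability (s≤s (s≤s (s≤s (s≤s (s≤s (s≤s (s≤s _))))))) =
  consecutiveEars⇒¬isComparability inj₂ id inj₁

module _ {G : Graph} (rank : V G → ℕ) where

  Ascending : V G → V G → Set
  Ascending u v = E G u v × rank u < rank v

  ascending-isTransitiveOrientation :
    Symmetric (E G) →
    (∀ u v → E G u v → rank u ≢ rank v) →
    (∀ u v w → Ascending u v → Ascending v w → E G u w) →
    IsTransitiveOrientation G Ascending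
  ascending-isTransitiveOrientation E-sym separates shortcut = record
    { onlyEdges  = λ _ _ → proj₁
    ; covers     = covers
    ; asym       = λ _ _ (_ , u<v) (_ , v<u) → <-asym u<v v<u
    ; transitive = λ u v w u↗v v↗w →
        shortcut u v w u↗v v↗w , <-trans (proj₂ u↗v) (proj₂ v↗w)
    }
    where
    covers : ∀ u v → E G u v → Ascending u v ⊎ Ascending v u
    covers u v u~v with <-cmp (rank u) (rank v)
    ... | tri< u<v _ _ = inj₁ (u~v , u<v)
    ... | tri≈ _ u≡v _ = contradiction u≡v (separates u v u~v)
    ... | tri> _ _ v<u = inj₂ (E-sym u~v , v<u)

Exhaustible : Set → Set₁
Exhaustible A = ∀ {P : Pred A 0ℓ} → Decidable P → Dec (∀ x → P x)

⊎-exhaustible : ∀ {A B} → Exhaustible A → Exhaustible B → Exhaustible (A ⊎ B)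
⊎-exhaustible ∀A? ∀B? P? =
  map′ (λ (onA , onB) → [ onA , onB ]) (λ onAll → onAll ∘ inj₁ , onAll ∘ inj₂)
       (∀A? (P? ∘ inj₁) ×-dec ∀B? (P? ∘ inj₂))

module _ (G : Graph) (E-sym : Symmetric (E G)) (E? : ∀ u v → Dec (E G u v))
         (∀V? : Exhaustible (V G)) (rank : V G → ℕ) where

  isComparability-byRank :
    {_ : True (∀V? λ u → ∀V? λ v → E? u v →-dec ¬? (rank u ≟ rank v))} →
    {_ : True (∀V? λ u → ∀V? λ v → ∀V? λ w →
                 (E? u v ×-dec rank u <? rank v) →-dec
                 (E? v w ×-dec rank v <? rank w) →-dec E? u w)} →
    IsComparability G
  isComparability-byRank {separates} {shortcut} =
    Ascending rank , ascending-isTransitiveOrientation rank E-sym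
                       (toWitness separates) (toWitness shortcut)

F₀-rank : Fin 5 ⊎ Fin 3 → ℕ
F₀-rank (inj₁ zero)                         = 0
F₀-rank (inj₁ (suc zero))                   = 2
F₀-rank (inj₁ (suc (suc zero)))             = 4
F₀-rank (inj₁ (suc (suc (suc zero))))       = 5
F₀-rank (inj₁ (suc (suc (suc (suc zero))))) = 1
F₀-rank (inj₂ _)                            = 3

F₀-isComparability : IsComparability F0
F₀-isComparability =
  isComparability-byRank F0 (λ {u} {v} → splitEdge-sym _ {u} {v})
    (splitEdge? _ Fin._≟_ (λ a c → T? (F0-table a c)))
    (⊎-exhaustible Fin.all? Fin.all?) F₀-rank

F₁₅-rank : Fin 4 ⊎ (Fin 2 ⊎ Fin 3) → ℕ
F₁₅-rank (inj₁ zero)                   = 4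
F₁₅-rank (inj₁ (suc zero))             = 6
F₁₅-rank (inj₁ (suc (suc zero)))       = 0
F₁₅-rank (inj₁ (suc (suc (suc zero)))) = 2
F₁₅-rank (inj₂ (inj₂ (suc zero)))      = 1
F₁₅-rank (inj₂ _)                      = 3

F₁₅-neighbour? : ∀ a c → Dec (F1N 5 a c)
F₁₅-neighbour? (inj₁ zero)       c = toℕ c <? 3
F₁₅-neighbour? (inj₁ (suc zero)) c = 1 ≤? toℕ c
F₁₅-neighbour? (inj₂ a)          c = (toℕ c ≟ toℕ a) ⊎-dec (toℕ c ≟ suc (toℕ a))

F₁₅-isComparability : IsComparability (F1 5)
F₁₅-isComparability =
  isComparability-byRank (F1 5) (λ {u} {v} → splitEdge-sym (F1N 5) {u} {v})
    (splitEdge? (F1N 5) Fin._≟_ F₁₅-neighbour?)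
    (⊎-exhaustible Fin.all? (⊎-exhaustible Fin.all? Fin.all?)) F₁₅-rank

¬odd6 : ¬ Odd 6
¬odd6 (m , 6≡1+2m) = even≢odd 3 m 6≡1+2m

F₁-isComparability⇒≡5 : ∀ {k} → Odd k → 5 ≤ k → IsComparability (F1 k) → k ≡ 5
F₁-isComparability⇒≡5 odd 5≤k comparable with m≤n⇒m<n∨m≡n 5≤k
... | inj₂ refl = refl
... | inj₁ 6≤k with m≤n⇒m<n∨m≡n 6≤k
...   | inj₂ refl = contradiction odd ¬odd6
...   | inj₁ 7≤k  = contradiction comparable (F₁-¬isComparability 7≤k)

-- The parity hypotheses only serve to exclude F₁(6).
theorem7 : IsComparability F0
           × (∀ (k : ℕ) → Even k → 4 ≤ k → ¬ IsComparability (sun k))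
           × (∀ (k : ℕ) → Odd k → 5 ≤ k → (IsComparability (F1 k) ⇔ k ≡ 5))
           × (∀ (k : ℕ) → Odd k → 5 ≤ k → ¬ IsComparability (F2 k))
theorem7 = F₀-isComparability
         , (λ _ _ → sun-¬isComparability)
         , (λ _ odd 5≤k → mk⇔ (F₁-isComparability⇒≡5 odd 5≤k)
                                (λ { refl → F₁₅-isComparability }))
         , (λ _ _ → F₂-¬isComparability)
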